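{- There exists a finite colouring of $\mathbb{N}$ such that there is no monochromatic pair $\{a,a^{b^{b^b}}\}$ with integers $a,b>1$.
   Context: Here $a^{b^{b^b}}$ means $a\star(b\star(b\star b))$ where $x\star y=x^y$. A finite colouring is a function from $\mathbb{N}$ to a finite set; a pair is monochromatic if both elements receive the same colour. -}

module Defs where

open import Data.Nat using (ℕ; _^_)

tower : ℕ → ℕ → ℕ
tower a b = a ^ (b ^ (b ^ b))

-- Let Ω n count the prime factors of n with multiplicity. For a, b > 1,
-- Ω (Ω (a ^ b ^ b ^ b)) = Ω (Ω a) + b ^ b * Ω b, and the shifts b ^ b * Ω b at least quadruple
-- from one b to the next. So it suffices to colour a by the colour of Ω (Ω a) in a colouring
-- of ℕ in which x and x + d k never agree, for a lacunary sequence d (d (k + 1) ≥ 4 d k).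
-- Nested intervals give a real α with α d k within 1/4 of ℤ + 1/2 for every k, and then
-- x ↦ ⌊5 {α x}⌋ is such a colouring. At x the colouring uses, instead of α, the rational
-- endpoint θ (10 x) of the (10 x)-th interval: as d (10 x) ≥ 10 x, θ (10 x) x is within 1/20
-- of α x, and θ (10 y) still has the property of α on every shift d k ≤ y.
module Submission where

open import Data.Fin using (Fin; fromℕ<)
open import Data.Fin.Properties using (fromℕ<-injective)
open import Data.List using ([]; _∷_; _++_; length)
open import Data.List.Properties using (length-++)
open import Data.List.Relation.Unary.All using (All; []; _∷_)
open import Data.List.Relation.Unary.All.Properties using (++⁺)
open import Data.List.Relation.Binary.Permutation.Propositional.Properties using (↭-length)
open import Data.Nat
open import Data.Nat.DivMod
open import Data.Nat.ListAction using (product)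
open import Data.Nat.ListAction.Properties using (product-++)
open import Data.Nat.Primality using (Prime; prime⇒nonTrivial)
open import Data.Nat.Primality.Factorisation
open import Data.Nat.Properties
open import Data.Nat.Tactic.RingSolver using (solve-∀)
open import Data.Product using (Σ; _,_)
open import Function using (_∘_)
open import Relation.Binary.Definitions using (Reflexive; Transitive)
open import Relation.Binary.PropositionalEquality
open import Relation.Nullary using (yes; no)

open import Defs

open PrimeFactorisation using (isFactorisation; factorsPrime)

Ω : ℕ → ℕ
Ω zero      = 0
Ω n@(suc _) = length (factors (factorise n))

Ω≡length-factors : ∀ n .{{_ : NonZero n}} (f : PrimeFactorisation n) → Ω n ≡ length (factors f)
Ω≡length-factors n@(suc _) f = ↭-length (factorisationUnique (factorise n) f)

Ω-* : ∀ m n .{{_ : NonZero m}} .{{_ : NonZero n}} → Ω (m * n) ≡ Ω m + Ω n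
Ω-* m@(suc _) n@(suc _) = trans (Ω≡length-factors (m * n) fm++fn) (length-++ (factors fm))
  where
  fm = factorise m
  fn = factorise n
  fm++fn : PrimeFactorisation (m * n)
  fm++fn = record
    { factors         = factors fm ++ factors fn
    ; isFactorisation = trans (cong₂ _*_ (isFactorisation fm) (isFactorisation fn))
                              (sym (product-++ (factors fm) (factors fn)))
    ; factorsPrime    = ++⁺ (factorsPrime fm) (factorsPrime fn)
    }

Ω-^ : ∀ m k .{{_ : NonZero m}} → Ω (m ^ k) ≡ k * Ω m
Ω-^ m zero    = Ω≡length-factors 1 primeFactorisation[1]
Ω-^ m (suc k) = trans (Ω-* m (m ^ k)) (cong (Ω m +_) (Ω-^ m k))
  where instance _ = m^n≢0 m k

Ω-pos : ∀ {n} → 1 < n → 0 < Ω n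
Ω-pos {n@(suc (suc _))} _ with factors (factorise n) | isFactorisation (factorise n)
... | []    | ()
... | _ ∷ _ | _ = z<s
Ω-pos {1} (s≤s ())

2^length≤product : ∀ {ps} → All Prime ps → 2 ^ length ps ≤ product ps
2^length≤product []         = ≤-refl
2^length≤product (pr ∷ prs) =
  *-mono-≤ (nonTrivial⇒n>1 _ {{prime⇒nonTrivial pr}}) (2^length≤product prs)

2^Ω≤n : ∀ n .{{_ : NonZero n}} → 2 ^ Ω n ≤ n
2^Ω≤n n@(suc _) = subst (2 ^ Ω n ≤_) (sym (isFactorisation (factorise n)))
                        (2^length≤product (factorsPrime (factorise n)))

-- Bernoulli's inequality (1 + 1/b) ^ k ≥ 1 + k/b, cleared of denominators.
bernoulli : ∀ b k → b ^ k * (b + k) ≤ suc b ^ k * b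
bernoulli b zero    = ≤-reflexive (cong (1 *_) (+-identityʳ b))
bernoulli b (suc k) = begin
  b ^ suc k * (b + suc k)       ≡⟨ step₁ b (b ^ k) k ⟩
  b ^ k * (b * (b + suc k))     ≤⟨ *-monoʳ-≤ (b ^ k) (m≤m+n _ k) ⟩
  b ^ k * (b * (b + suc k) + k) ≡⟨ step₂ b (b ^ k) k ⟩
  b ^ k * (b + k) * suc b       ≤⟨ *-monoˡ-≤ (suc b) (bernoulli b k) ⟩
  suc b ^ k * b * suc b         ≡⟨ step₃ b (suc b ^ k) ⟩
  suc b ^ suc k * b             ∎
  where
  open ≤-Reasoning
  step₁ : ∀ b p k → b * p * (b + suc k) ≡ p * (b * (b + suc k))
  step₁ = solve-∀
  step₂ : ∀ b p k → p * (b * (b + suc k) + k) ≡ p * (b + k) * suc b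
  step₂ = solve-∀
  step₃ : ∀ b p → p * b * suc b ≡ suc b * p * b
  step₃ = solve-∀

2*n≤2^n : ∀ n → 2 * n ≤ 2 ^ n
2*n≤2^n zero    = z≤n
2*n≤2^n (suc n) = *-monoʳ-≤ 2 (begin
  suc n           ≡⟨ sym (trans (cong (_* suc n) (^-zeroˡ n)) (*-identityˡ (suc n))) ⟩
  1 ^ n * (1 + n) ≤⟨ bernoulli 1 n ⟩
  2 ^ n * 1       ≡⟨ *-identityʳ (2 ^ n) ⟩
  2 ^ n           ∎)
  where open ≤-Reasoning

2*Ω≤n : ∀ n .{{_ : NonZero n}} → 2 * Ω n ≤ n
2*Ω≤n n = ≤-trans (2*n≤2^n (Ω n)) (2^Ω≤n n)

b^b*2[1+b]≤[1+b]^[1+b] : ∀ b .{{_ : NonZero b}} → b ^ b * (2 * suc b) ≤ suc b ^ suc b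
b^b*2[1+b]≤[1+b]^[1+b] b = *-cancelʳ-≤ _ _ b (begin
  b ^ b * (2 * suc b) * b   ≡⟨ regroup b (b ^ b) ⟩
  suc b * (b ^ b * (b + b)) ≤⟨ *-monoʳ-≤ (suc b) (bernoulli b b) ⟩
  suc b * (suc b ^ b * b)   ≡⟨ *-assoc (suc b) (suc b ^ b) b ⟨
  suc b ^ suc b * b         ∎)
  where
  open ≤-Reasoning
  regroup : ∀ b p → p * (2 * suc b) * b ≡ suc b * (p * (b + b))
  regroup = solve-∀

towerShift : ℕ → ℕ
towerShift b = b ^ b * Ω b

towerShift-pos : ∀ {b} → 1 < b → 0 < towerShift b
towerShift-pos {b@(suc _)} 1<b = *-mono-≤ (m^n>0 b b) (Ω-pos 1<b)

towerShift-lacunary : ∀ {b} → 1 < b → 4 * towerShift b ≤ towerShift (suc b)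
towerShift-lacunary {b@(suc _)} 1<b = begin
  4 * (b ^ b * Ω b)       ≡⟨ regroup (b ^ b) (Ω b) ⟩
  b ^ b * (2 * (2 * Ω b)) ≤⟨ *-monoʳ-≤ (b ^ b) (*-monoʳ-≤ 2 (≤-trans (2*Ω≤n b) (n≤1+n b))) ⟩
  b ^ b * (2 * suc b)     ≤⟨ b^b*2[1+b]≤[1+b]^[1+b] b ⟩
  suc b ^ suc b           ≤⟨ m≤m*n (suc b ^ suc b) (Ω (suc b)) ⟩
  suc b ^ suc b * Ω (suc b) ∎
  where
  open ≤-Reasoning
  regroup : ∀ p w → 4 * (p * w) ≡ p * (2 * (2 * w))
  regroup = solve-∀
  instance _ = >-nonZero (Ω-pos (m<n⇒m<1+n 1<b))

ΩΩ-tower : ∀ a b .{{_ : NonZero b}} → 1 < a → Ω (Ω (tower a b)) ≡ Ω (Ω a) + towerShift b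
ΩΩ-tower a@(suc _) b 1<a = begin
  Ω (Ω (a ^ M))          ≡⟨ cong Ω (Ω-^ a M) ⟩
  Ω (M * Ω a)            ≡⟨ Ω-* M (Ω a) ⟩
  Ω M + Ω (Ω a)          ≡⟨ cong (_+ Ω (Ω a)) (Ω-^ b (b ^ b)) ⟩
  towerShift b + Ω (Ω a) ≡⟨ +-comm (towerShift b) (Ω (Ω a)) ⟩
  Ω (Ω a) + towerShift b ∎
  where
  open ≡-Reasoning
  M = b ^ (b ^ b)
  instance
    _ = m^n≢0 b (b ^ b)
    _ = >-nonZero (Ω-pos 1<a)

sector : ℕ → (G : ℕ) .{{_ : NonZero G}} → ℕ
sector v G = 5 * (v % G) / G

sector<5 : ∀ v G .{{_ : NonZero G}} → sector v G < 5
sector<5 v G = m<n*o⇒m/o<n (*-monoʳ-< 5 (m%n<n v G))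

sector-congʳ : ∀ v {G H} .{{_ : NonZero G}} .{{_ : NonZero H}} → G ≡ H → sector v G ≡ sector v H
sector-congʳ v refl = refl

sector-+* : ∀ v k G .{{_ : NonZero G}} → sector (v + k * G) G ≡ sector v G
sector-+* v k G = cong (λ r → 5 * r / G) ([m+kn]%n≡m%n v k G)

sector-* : ∀ v G c .{{_ : NonZero G}} .{{_ : NonZero c}} .{{_ : NonZero (G * c)}} →
           sector (v * c) (G * c) ≡ sector v G
sector-* v G c = begin
  5 * (v * c % (G * c)) / (G * c) ≡⟨ cong (λ r → 5 * r / (G * c)) (m%n*o≡m*o%[n*o] v G c) ⟨
  5 * (v % G * c) / (G * c)       ≡⟨ /-congˡ (*-assoc 5 (v % G) c) ⟨
  5 * (v % G) * c / (G * c)       ≡⟨ m*n/o*n≡m/o (5 * (v % G)) c G ⟩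
  5 * (v % G) / G                 ∎
  where open ≡-Reasoning

[m+n]/n≡1+m/n : ∀ m n .{{_ : NonZero n}} → (m + n) / n ≡ suc (m / n)
[m+n]/n≡1+m/n m n = trans (m/n≡1+[m∸n]/n (m≤n+m n m)) (cong (λ k → suc (k / n)) (m+n∸n≡m m n))

m+n≤o⇒m/n<o/n : ∀ m n o .{{_ : NonZero n}} → m + n ≤ o → m / n < o / n
m+n≤o⇒m/n<o/n m n o m+n≤o = subst (_≤ o / n) ([m+n]/n≡1+m/n m n) (/-monoˡ-≤ n m+n≤o)

[m+n]%o≡[m%o+n]%o : ∀ m n o .{{_ : NonZero o}} → (m + n) % o ≡ (m % o + n) % o
[m+n]%o≡[m%o+n]%o m n o = begin
  (m + n) % o                ≡⟨ %-distribˡ-+ m n o ⟩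
  (m % o + n % o) % o        ≡⟨ cong (λ r → (r + n % o) % o) (m%n%n≡m%n m o) ⟨
  (m % o % o + n % o) % o    ≡⟨ %-distribˡ-+ (m % o) n o ⟨
  (m % o + n) % o            ∎
  where open ≡-Reasoning

-- Adding g ∈ [G/4, 4G/5] to the residue s either keeps it below G and raises it by at
-- least G/5, or wraps it around to a residue at least G/5 below s.
sector-+ : ∀ v g G .{{_ : NonZero G}} → G ≤ 4 * g → 5 * g ≤ 4 * G → sector v G ≢ sector (v + g) G
sector-+ v g G G≤4g 5g≤4G with v % G + g <? G
... | yes s+g<G = <⇒≢ (m+n≤o⇒m/n<o/n (5 * s) G _ (begin
  5 * s + G         ≤⟨ +-monoʳ-≤ (5 * s) (≤-trans G≤4g (*-monoˡ-≤ g (n≤1+n 4))) ⟩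
  5 * s + 5 * g     ≡⟨ *-distribˡ-+ 5 s g ⟨
  5 * (s + g)       ≡⟨ cong (5 *_) (m<n⇒m%n≡m s+g<G) ⟨
  5 * ((s + g) % G) ≡⟨ cong (5 *_) ([m+n]%o≡[m%o+n]%o v g G) ⟨
  5 * ((v + g) % G) ∎))
  where
  open ≤-Reasoning
  s = v % G
... | no s+g≮G = >⇒≢ (m+n≤o⇒m/n<o/n (5 * w) G (5 * s) 5w+G≤5s) ∘ λ same →
                   trans same (cong (λ r → 5 * r / G) [v+g]%G≡w)
  where
  open ≤-Reasoning
  s = v % G
  w = s + g ∸ G
  G+w≡s+g : G + w ≡ s + g
  G+w≡s+g = m+[n∸m]≡n (≮⇒≥ s+g≮G)
  g<G : g < G
  g<G = *-cancelˡ-< 5 g G (≤-<-trans 5g≤4G (*-monoˡ-< G (n<1+n 4)))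
  w<G : w < G
  w<G = +-cancelˡ-< G w G (subst (_< G + G) (sym G+w≡s+g) (+-mono-< (m%n<n v G) g<G))
  [v+g]%G≡w : (v + g) % G ≡ w
  [v+g]%G≡w = begin-equality
    (v + g) % G ≡⟨ [m+n]%o≡[m%o+n]%o v g G ⟩
    (s + g) % G ≡⟨ cong (_% G) (trans (sym G+w≡s+g) (+-comm G w)) ⟩
    (w + G) % G ≡⟨ [m+n]%n≡m%n w G ⟩
    w % G       ≡⟨ m<n⇒m%n≡m w<G ⟩
    w           ∎
  5w+G≤5s : 5 * w + G ≤ 5 * s
  5w+G≤5s = +-cancelʳ-≤ (4 * G) (5 * w + G) (5 * s) (begin
    5 * w + G + 4 * G ≡⟨ regroup w G ⟩
    5 * (G + w)       ≡⟨ cong (5 *_) G+w≡s+g ⟩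
    5 * (s + g)       ≡⟨ *-distribˡ-+ 5 s g ⟩
    5 * s + 5 * g     ≤⟨ +-monoʳ-≤ (5 * s) 5g≤4G ⟩
    5 * s + 4 * G     ∎)
    where
    regroup : ∀ w G → 5 * w + G + 4 * G ≡ 5 * (G + w)
    regroup = solve-∀

sector-separated : ∀ B Y G .{{_ : NonZero G}} → 4 * B + G ≤ 4 * Y → 5 * Y ≤ 5 * B + 4 * G →
                   sector B G ≢ sector Y G
sector-separated B Y G lower upper =
  subst (λ Y → sector B G ≢ sector Y G) B+g≡Y (sector-+ B g G G≤4g 5g≤4G)
  where
  B≤Y : B ≤ Y
  B≤Y = *-cancelˡ-≤ 4 (≤-trans (m≤m+n (4 * B) G) lower)
  g = Y ∸ B
  B+g≡Y : B + g ≡ Y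
  B+g≡Y = m+[n∸m]≡n B≤Y
  G≤4g : G ≤ 4 * g
  G≤4g = +-cancelˡ-≤ (4 * B) G (4 * g)
           (subst (4 * B + G ≤_) (trans (cong (4 *_) (sym B+g≡Y)) (*-distribˡ-+ 4 B g)) lower)
  5g≤4G : 5 * g ≤ 4 * G
  5g≤4G = +-cancelˡ-≤ (5 * B) (5 * g) (4 * G)
           (subst (_≤ 5 * B + 4 * G) (trans (cong (5 *_) (sym B+g≡Y)) (*-distribˡ-+ 5 B g)) upper)

fraction-≤-trans : ∀ a b c e f g .{{_ : NonZero e}} → a * e ≤ c * b → c * g ≤ f * e → a * g ≤ f * b
fraction-≤-trans a b c e f g ae≤cb cg≤fe = *-cancelʳ-≤ (a * g) (f * b) e (begin
  a * g * e ≡⟨ swap a g e ⟩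
  a * e * g ≤⟨ *-monoˡ-≤ g ae≤cb ⟩
  c * b * g ≡⟨ swap c b g ⟩
  c * g * b ≤⟨ *-monoˡ-≤ b cg≤fe ⟩
  f * e * b ≡⟨ swap f e b ⟩
  f * b * e ∎)
  where
  open ≤-Reasoning
  swap : ∀ x y z → x * y * z ≡ x * z * y
  swap = solve-∀

≤-induction : ∀ {R : ℕ → ℕ → Set} → Reflexive R → Transitive R → (∀ i → R i (suc i)) →
              ∀ {i j} → i ≤ j → R i j
≤-induction {R} reflexive transitive step = go ∘ ≤⇒≤′
  where
  go : ∀ {i j} → i ≤′ j → R i j
  go ≤′-refl       = reflexive
  go (≤′-step i≤j) = transitive (go i≤j) (step _)

-- With θ = a / 4p and θ' = b / 4q: if θ ≤ θ' and θ' r ≥ m + 1/4, then θ' (x + r) ≥ θ x + m + 1/4.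
gap-lower : ∀ a b m p q r x → a * q ≤ b * p → (4 * m + 1) * q ≤ b * r →
            4 * (a * x * (4 * q) + m * (4 * p * (4 * q))) + 4 * p * (4 * q)
              ≤ 4 * (b * (x + r) * (4 * p))
gap-lower a b m p q r x aq≤bp uq≤br = begin
  4 * (a * x * (4 * q) + m * (4 * p * (4 * q))) + 4 * p * (4 * q) ≡⟨ lhs a m p q x ⟩
  16 * (x * (a * q) + p * ((4 * m + 1) * q))
    ≤⟨ *-monoʳ-≤ 16 (+-mono-≤ (*-monoʳ-≤ x aq≤bp) (*-monoʳ-≤ p uq≤br)) ⟩
  16 * (x * (b * p) + p * (b * r))                                ≡⟨ rhs b p r x ⟩
  4 * (b * (x + r) * (4 * p))                                     ∎
  where
  open ≤-Reasoning
  lhs : ∀ a m p q x → 4 * (a * x * (4 * q) + m * (4 * p * (4 * q))) + 4 * p * (4 * q)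
                       ≡ 16 * (x * (a * q) + p * ((4 * m + 1) * q))
  lhs = solve-∀
  rhs : ∀ b p r x → 16 * (x * (b * p) + p * (b * r)) ≡ 4 * (b * (x + r) * (4 * p))
  rhs = solve-∀

-- Dually, if θ' + 2/4q ≤ θ + 2/4p, θ' r + 2r/4q ≤ m + 3/4 and x ≤ p/10,
-- then θ' (x + r) ≤ θ x + m + 4/5.
gap-upper : ∀ a b m p q r x → (b + 2) * p ≤ (a + 2) * q → (b + 2) * r ≤ (4 * m + 1 + 2) * q →
            10 * x ≤ p →
            5 * (b * (x + r) * (4 * p))
              ≤ 5 * (a * x * (4 * q) + m * (4 * p * (4 * q))) + 4 * (4 * p * (4 * q))
gap-upper a b m p q r x bp≤aq br≤uq 10x≤p = *-cancelˡ-≤ 4 (begin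
  4 * (5 * (b * (x + r) * (4 * p)))                             ≡⟨ lhs b p r x ⟩
  80 * (x * (b * p) + p * (b * r))
    ≤⟨ *-monoʳ-≤ 80 (+-mono-≤ (*-monoʳ-≤ x (drop₂ b p bp≤aq)) (*-monoʳ-≤ p (drop₂ b r br≤uq))) ⟩
  80 * (x * ((a + 2) * q) + p * ((4 * m + 1 + 2) * q))          ≡⟨ mid a m p q x ⟩
  16 * q * (10 * x) + 80 * (a * x * q + p * ((4 * m + 3) * q))
    ≤⟨ +-monoˡ-≤ _ (*-monoʳ-≤ (16 * q) 10x≤p) ⟩
  16 * q * p + 80 * (a * x * q + p * ((4 * m + 3) * q))         ≡⟨ rhs a m p q x ⟩
  4 * (5 * (a * x * (4 * q) + m * (4 * p * (4 * q))) + 4 * (4 * p * (4 * q))) ∎)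
  where
  open ≤-Reasoning
  drop₂ : ∀ b s {t} → (b + 2) * s ≤ t → b * s ≤ t
  drop₂ b s = ≤-trans (*-monoˡ-≤ s (m≤m+n b 2))
  lhs : ∀ b p r x → 4 * (5 * (b * (x + r) * (4 * p))) ≡ 80 * (x * (b * p) + p * (b * r))
  lhs = solve-∀
  mid : ∀ a m p q x → 80 * (x * ((a + 2) * q) + p * ((4 * m + 1 + 2) * q))
                       ≡ 16 * q * (10 * x) + 80 * (a * x * q + p * ((4 * m + 3) * q))
  mid = solve-∀
  rhs : ∀ a m p q x → 16 * q * p + 80 * (a * x * q + p * ((4 * m + 3) * q))
                       ≡ 4 * (5 * (a * x * (4 * q) + m * (4 * p * (4 * q))) + 4 * (4 * p * (4 * q)))
  rhs = solve-∀

module LacunaryColouring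
  (d : ℕ → ℕ) (d-pos : ∀ i → 0 < d i) (d-lacunary : ∀ i → 4 * d i ≤ d (suc i)) where

  instance
    d-nonZero : ∀ {i} → NonZero (d i)
    d-nonZero {i} = >-nonZero (d-pos i)

    4d-nonZero : ∀ {i} → NonZero (4 * d i)
    4d-nonZero {i} = m*n≢0 4 (d i)

  i<d : ∀ i → i < d i
  i<d zero    = d-pos 0
  i<d (suc i) = ≤-<-trans (i<d i) (<-≤-trans d<4d (d-lacunary i))
    where
    d<4d : d i < 4 * d i
    d<4d = subst (d i <_) (*-comm (d i) 4) (m<m*n (d i) 4 (s≤s (s≤s z≤n)))

  -- The intervals [u i / d i , (u i + 2) / d i] are nested (ascending, descending), so a
  -- 4α in all of them has α d i ∈ [m i + 1/4 , m i + 3/4] for every i.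
  m : ℕ → ℕ
  m zero    = 0
  m (suc i) = (4 * m i + 1) * d (suc i) / (4 * d i) + 1

  u : ℕ → ℕ
  u i = 4 * m i + 1

  u-step-lower : ∀ i → u i * d (suc i) ≤ u (suc i) * d i
  u-step-lower i = begin
    A                                 ≡⟨ m≡m%n+[m/n]*n A (4 * d i) ⟩
    A % (4 * d i) + q * (4 * d i)     ≤⟨ +-monoˡ-≤ (q * (4 * d i)) (m%n≤n A (4 * d i)) ⟩
    4 * d i + q * (4 * d i)           ≤⟨ m≤m+n _ (d i) ⟩
    4 * d i + q * (4 * d i) + d i     ≡⟨ regroup q (d i) ⟩
    (4 * (q + 1) + 1) * d i           ∎
    where
    open ≤-Reasoning
    A = u i * d (suc i)
    q = A / (4 * d i)
    regroup : ∀ q e → 4 * e + q * (4 * e) + e ≡ (4 * (q + 1) + 1) * e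
    regroup = solve-∀

  u-step-upper : ∀ i → (u (suc i) + 2) * d i ≤ (u i + 2) * d (suc i)
  u-step-upper i = begin
    (4 * (q + 1) + 1 + 2) * d i       ≤⟨ m≤m+n _ (d i) ⟩
    (4 * (q + 1) + 1 + 2) * d i + d i ≡⟨ regroup q (d i) ⟩
    q * (4 * d i) + 2 * (4 * d i)     ≤⟨ +-mono-≤ (m/n*n≤m A (4 * d i)) (*-monoʳ-≤ 2 (d-lacunary i)) ⟩
    A + 2 * d (suc i)                 ≡⟨ *-distribʳ-+ (d (suc i)) (u i) 2 ⟨
    (u i + 2) * d (suc i)             ∎
    where
    open ≤-Reasoning
    A = u i * d (suc i)
    q = A / (4 * d i)
    regroup : ∀ q e → (4 * (q + 1) + 1 + 2) * e + e ≡ q * (4 * e) + 2 * (4 * e)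
    regroup = solve-∀

  ascending : ∀ {i j} → i ≤ j → u i * d j ≤ u j * d i
  ascending = ≤-induction {λ i j → u i * d j ≤ u j * d i} ≤-refl
    (λ {i} {j} {k} → fraction-≤-trans (u i) (d i) (u j) (d j) (u k) (d k)) u-step-lower

  descending : ∀ {i j} → i ≤ j → (u j + 2) * d i ≤ (u i + 2) * d j
  descending = ≤-induction {λ i j → (u j + 2) * d i ≤ (u i + 2) * d j}
    ≤-refl
    (λ {i} {j} {k} ij jk → fraction-≤-trans (u k + 2) (d k) (u j + 2) (d j) (u i + 2) (d i) jk ij)
    u-step-upper

  colour : ℕ → Fin 5
  colour x = fromℕ< (sector<5 (u (10 * x) * x) (4 * d (10 * x)))

  colour-separates : ∀ x k → colour x ≢ colour (x + d k)
  colour-separates x k same = sector-separated (X + m k * G) Y G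
    (gap-lower (u P) (u Q) (m k) (d P) (d Q) (d k) x (ascending P≤Q) (ascending k≤Q))
    (gap-upper (u P) (u Q) (m k) (d P) (d Q) (d k) x (descending P≤Q) (descending k≤Q) (<⇒≤ (i<d P)))
    (begin
      sector (X + m k * G) G         ≡⟨ sector-+* X (m k) G ⟩
      sector X G                     ≡⟨ sector-* (u P * x) (4 * d P) (4 * d Q) ⟩
      sector (u P * x) (4 * d P)     ≡⟨ fromℕ<-injective _ _ _ _ same ⟩
      sector (u Q * y) (4 * d Q)     ≡⟨ sector-* (u Q * y) (4 * d Q) (4 * d P) ⟨
      sector Y (4 * d Q * (4 * d P)) ≡⟨ sector-congʳ Y (*-comm (4 * d Q) (4 * d P)) ⟩
      sector Y G                     ∎)
    where
    open ≡-Reasoning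
    y = x + d k
    P = 10 * x
    Q = 10 * y
    X = u P * x * (4 * d Q)
    Y = u Q * y * (4 * d P)
    G = 4 * d P * (4 * d Q)
    instance
      _ = m*n≢0 (4 * d P) (4 * d Q)
      _ = m*n≢0 (4 * d Q) (4 * d P)
    P≤Q : P ≤ Q
    P≤Q = *-monoʳ-≤ 10 (m≤m+n x (d k))
    k≤Q : k ≤ Q
    k≤Q = ≤-trans (<⇒≤ (i<d k)) (≤-trans (m≤n+m (d k) x) (m≤n*m y 10))

proposition28 : Σ ℕ λ k → Σ (ℕ → Fin k) λ c →
    (a b : ℕ) → 1 < a → 1 < b → c a ≢ c (tower a b)
proposition28 = 5 , colour ∘ Ω ∘ Ω , tower-pairs-separated
  where
  open LacunaryColouring (towerShift ∘ (2 +_)) (λ i → towerShift-pos {2 + i} (s≤s (s≤s z≤n)))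
                         (λ i → towerShift-lacunary {2 + i} (s≤s (s≤s z≤n)))
  tower-pairs-separated : ∀ a b → 1 < a → 1 < b → colour (Ω (Ω a)) ≢ colour (Ω (Ω (tower a b)))
  tower-pairs-separated a b@(suc (suc i)) 1<a _ =
    subst (λ z → colour (Ω (Ω a)) ≢ colour z) (sym (ΩΩ-tower a b 1<a))
          (colour-separates (Ω (Ω a)) i)
  tower-pairs-separated a 1 _ (s≤s ())
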